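{- Let $\mathcal{E}_{\mathtt{RS}} = \mathcal{E}_1 \cup \{\mathrm{RS}, \mathrm{RSP1}, \mathrm{RSP2}, \mathrm{EL2}\}$. For all closed $\mathrm{BCCSP}_{\|}$ terms $p,q$: if $\mathcal{E}_{\mathtt{RS}}\vdash p\approx q$ then $p\sim_{\mathtt{RS}} q$.
   Context: Let $\mathcal{A}$ be a finite non-empty set of actions and $\mathcal{V}$ a countably infinite set of variables. $\mathrm{BCCSP}_{\|}$ terms: $t ::= \mathbf{0} \mid x \mid a.t \mid t+t \mid t \,\|\, t$ ($a\in\mathcal{A}$, $x \in \mathcal{V}$; $ax$ means $a.x$). Closed terms are processes. Transitions: $a.p \xrightarrow{a} p$; if $p \xrightarrow{a} p'$ then $p+q \xrightarrow{a} p'$, $q+p \xrightarrow{a} p'$, $p\|q \xrightarrow{a} p'\|q$, $q \| p \xrightarrow{a} q \| p'$. $\mathtt{I}(p)=\{a\mid\exists p'.\,p\xrightarrow{a}p'\}$. A ready simulation is a relation $R$ on processes such that $pRq$ implies $\mathtt{I}(p)=\mathtt{I}(q)$, and $pRq$, $p\xrightarrow{a}p'$ imply $q\xrightarrow{a}q'$ with $p'Rq'$ for some $q'$. $p\sqsubseteq_{\mathtt{RS}}q$ iff $pRq$ for some ready simulation $R$; $p\sim_{\mathtt{RS}}q$ iff $p\sqsubseteq_{\mathtt{RS}}q$ and $q\sqsubseteq_{\mathtt{RS}}p$. $\mathcal{E}\vdash t\approx u$: derivable in equational logic (reflexivity, symmetry, transitivity, substitution instances of axioms, closure under $a.\_$,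 $+$, $\|$). Axioms with concrete action names stand for all instances with actions from $\mathcal{A}$. $\mathcal{E}_1$: A0 $x+\mathbf{0}\approx x$; A1 $x+y\approx y+x$; A2 $(x+y)+z \approx x+(y+z)$; A3 $x+x\approx x$; P0 $x\|\mathbf{0}\approx x$; P1 $x\|y \approx y \| x$. RS: $a(bx+by+z)\approx a(bx+by+z)+a(bx+z)$. RSP1: $(ax+ay+u)\|(bz+bw+v) \approx (ax+u)\|(bz+bw+v) + (ay+u)\|(bz+bw+v) + (ax+ay+u)\|(bz+v) + (ax+ay+u)\|(bw+v)$. RSP2: $(\sum_{i\in I} a_i x_i)\|(by+bz+w) \approx (\sum_{i\in I} a_ix_i)\|(by+w) + (\sum_{i\in I} a_ix_i)\|(bz+w) + \sum_{i\in I} a_i(x_i \| (by+bz+w))$, $I$ finite, $a_j\neq a_k$ for $j\neq k$. EL2: $\sum_{i\in I} a_ix_i \| \sum_{j\in J} b_jy_j \approx \sum_{i\in I} a_i(x_i \| \sum_{j\in J} b_j y_j) + \sum_{j\in J} b_j(\sum_{i\in I} a_i x_i \| y_j)$, $I,J$ finite, the $a_i$ pairwise distinct and the $b_j$ pairwise distinct. -}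

module Defs where

open import Data.Nat using (ℕ; suc)
open import Data.Fin using (Fin)
open import Data.Product using (_×_; _,_; proj₁; ∃; Σ)
open import Data.List using (List; []; _∷_; map)
open import Data.List.Relation.Unary.Unique.Propositional using (Unique)
open import Function.Bundles using (_⇔_)

Act : ℕ → Set
Act n = Fin (suc n)

Var : Set
Var = ℕ

infixl 6 _⊕_
infixl 5 _∥_

data Term (n : ℕ) : Set where
  𝟎   : Term n
  var : Var → Term n
  _·_ : Act n → Term n → Term n
  _⊕_ : Term n → Term n → Term n
  _∥_ : Term n → Term n → Term n

infixr 7 _·_

data Closed {n : ℕ} : Term n → Set where
  c𝟎 : Closed 𝟎
  c· : ∀ {a t} → Closed t → Closed (a · t)
  c⊕ : ∀ {t u} → Closed t → Closed u → Closed (t ⊕ u)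
  c∥ : ∀ {t u} → Closed t → Closed u → Closed (t ∥ u)

Sum : ∀ {n} → List (Term n) → Term n
Sum []           = 𝟎
Sum (t ∷ [])     = t
Sum (t ∷ u ∷ ts) = t ⊕ Sum (u ∷ ts)

PSum : ∀ {n} → List (Act n × Term n) → Term n
PSum l = Sum (map (λ { (a , t) → a · t }) l)

DistinctActs : ∀ {n} → List (Act n × Term n) → Set
DistinctActs l = Unique (map proj₁ l)

data _—[_]→_ {n : ℕ} : Term n → Act n → Term n → Set where
  pre  : ∀ {a t} → (a · t) —[ a ]→ t
  sumˡ : ∀ {p q a p'} → p —[ a ]→ p' → (p ⊕ q) —[ a ]→ p'
  sumʳ : ∀ {p q a p'} → p —[ a ]→ p' → (q ⊕ p) —[ a ]→ p'
  parˡ : ∀ {p q a p'} → p —[ a ]→ p' → (p ∥ q) —[ a ]→ (p' ∥ q)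
  parʳ : ∀ {p q a p'} → p —[ a ]→ p' → (q ∥ p) —[ a ]→ (q ∥ p')

Can : ∀ {n} → Term n → Act n → Set
Can p a = ∃ λ p' → p —[ a ]→ p'

SameInit : ∀ {n} → Term n → Term n → Set
SameInit p q = ∀ a → Can p a ⇔ Can q a

record IsReadySim {n : ℕ} (R : Term n → Term n → Set) : Set where
  field
    closedˡ : ∀ {p q} → R p q → Closed p
    closedʳ : ∀ {p q} → R p q → Closed q
    init    : ∀ {p q} → R p q → SameInit p q
    step    : ∀ {p q a p'} → R p q → p —[ a ]→ p' →
              ∃ λ q' → (q —[ a ]→ q') × R p' q'

_⊑RS_ : ∀ {n} → Term n → Term n → Set₁
_⊑RS_ {n} p q = Σ (Term n → Term n → Set) λ R → IsReadySim R × R p q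

_∼RS_ : ∀ {n} → Term n → Term n → Set₁
p ∼RS q = (p ⊑RS q) × (q ⊑RS p)

-- Axioms of E_RS = E1 ∪ {RS, RSP1, RSP2, EL2}, given as all their
-- substitution instances (metavariables range over arbitrary terms).
data E-RS {n : ℕ} : Term n → Term n → Set where
  A0  : ∀ x → E-RS (x ⊕ 𝟎) x
  A1  : ∀ x y → E-RS (x ⊕ y) (y ⊕ x)
  A2  : ∀ x y z → E-RS ((x ⊕ y) ⊕ z) (x ⊕ (y ⊕ z))
  A3  : ∀ x → E-RS (x ⊕ x) x
  P0  : ∀ x → E-RS (x ∥ 𝟎) x
  P1  : ∀ x y → E-RS (x ∥ y) (y ∥ x)
  RS  : ∀ a b x y z →
        E-RS (a · (b · x ⊕ b · y ⊕ z))
             (a · (b · x ⊕ b · y ⊕ z) ⊕ a · (b · x ⊕ z))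
  RSP1 : ∀ a b x y u z w v →
        E-RS ((a · x ⊕ a · y ⊕ u) ∥ (b · z ⊕ b · w ⊕ v))
             (((a · x ⊕ u) ∥ (b · z ⊕ b · w ⊕ v))
              ⊕ ((a · y ⊕ u) ∥ (b · z ⊕ b · w ⊕ v))
              ⊕ ((a · x ⊕ a · y ⊕ u) ∥ (b · z ⊕ v))
              ⊕ ((a · x ⊕ a · y ⊕ u) ∥ (b · w ⊕ v)))
  RSP2 : ∀ (l : List (Act n × Term n)) → DistinctActs l → ∀ b y z w →
        E-RS (PSum l ∥ (b · y ⊕ b · z ⊕ w))
             ((PSum l ∥ (b · y ⊕ w))
              ⊕ (PSum l ∥ (b · z ⊕ w))
              ⊕ PSum (map (λ { (a , x) → (a , (x ∥ (b · y ⊕ b · z ⊕ w))) }) l))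
  EL2 : ∀ (l k : List (Act n × Term n)) → DistinctActs l → DistinctActs k →
        E-RS (PSum l ∥ PSum k)
             (PSum (map (λ { (a , x) → (a , (x ∥ PSum k)) }) l)
              ⊕ PSum (map (λ { (b , y) → (b , (PSum l ∥ y)) }) k))

data _⊢_≈_ {n : ℕ} (E : Term n → Term n → Set) : Term n → Term n → Set where
  ax     : ∀ {t u} → E t u → E ⊢ t ≈ u
  refl   : ∀ {t} → E ⊢ t ≈ t
  sym    : ∀ {t u} → E ⊢ t ≈ u → E ⊢ u ≈ t
  trans  : ∀ {t u v} → E ⊢ t ≈ u → E ⊢ u ≈ v → E ⊢ t ≈ v
  cong·  : ∀ {a t u} → E ⊢ t ≈ u → E ⊢ (a · t) ≈ (a · u)
  cong⊕  : ∀ {t t' u u'} → E ⊢ t ≈ t' → E ⊢ u ≈ u' → E ⊢ (t ⊕ u) ≈ (t' ⊕ u')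
  cong∥  : ∀ {t t' u u'} → E ⊢ t ≈ t' → E ⊢ u ≈ u' → E ⊢ (t ∥ u) ≈ (t' ∥ u')

-- Every term denotes a finite, acyclic process, so the ready-simulation
-- preorder can be defined inductively: p ≼ q when each a-step of p is matched
-- by an a-step of q with related residuals, and every initial action of q is
-- one of p. Because transitions strictly decrease term size, any relation that
-- is a ready simulation up to ≼ is contained in ≼; this yields reflexivity,
-- transitivity and compatibility with ∥. Every axiom instance is then
-- verified by matching transitions directly (variables act as deadlocked
-- processes), so derivable equations relate mutually ready-similar terms, and
-- ≼ restricted to closed terms is a ready simulation.
module Submission where

open import Data.Nat using (ℕ; suc; _+_; _<_; s≤s)
open import Data.Nat.Properties
  using (≤-refl; ≤-trans; m≤m+n; m≤n+m; n≤1+n; +-monoˡ-<; +-monoʳ-<; <-≤-trans)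
open import Data.Product using (_×_; _,_; proj₁; proj₂; ∃)
open import Data.Sum using (_⊎_; inj₁; inj₂)
open import Data.List using (List; []; _∷_; map)
open import Data.List.Relation.Unary.Any using (here; there)
open import Data.List.Membership.Propositional using (_∈_)
open import Data.List.Membership.Propositional.Properties using (∈-map⁺; ∈-map⁻)
open import Relation.Binary.PropositionalEquality as ≡ using (_≡_; subst)
open import Function.Bundles using (mk⇔)
open import Defs

module _ {n : ℕ} where

  size : Term n → ℕ
  size 𝟎       = 1
  size (var _) = 1
  size (a · t) = suc (size t)
  size (t ⊕ u) = suc (size t + size u)
  size (t ∥ u) = suc (size t + size u)

  step-size< : ∀ {p a p'} → p —[ a ]→ p' → size p' < size p
  step-size< pre = ≤-refl
  step-size< (sumˡ {p} {q} s) = <-≤-trans (step-size< s) (≤-trans (m≤m+n (size p) (size q)) (n≤1+n _))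
  step-size< (sumʳ {p} {q} s) = <-≤-trans (step-size< s) (≤-trans (m≤n+m (size p) (size q)) (n≤1+n _))
  step-size< (parˡ {p} {q} s) = s≤s (+-monoˡ-< (size q) (step-size< s))
  step-size< (parʳ {p} {q} s) = s≤s (+-monoʳ-< (size q) (step-size< s))

  -- The inclusion I(p) ⊆ I(q) is implied by the first field.
  data _≼_ : Term n → Term n → Set where
    ready-sim : ∀ {p q}
      → (∀ {a p'} → p —[ a ]→ p' → ∃ λ q' → (q —[ a ]→ q') × (p' ≼ q'))
      → (∀ {a q'} → q —[ a ]→ q' → Can p a)
      → p ≼ q

  Simulated : Term n → Term n → Set
  Simulated p q = ∀ {a p'} → p —[ a ]→ p' → ∃ λ q' → (q —[ a ]→ q') × (p' ≼ q')

  InitialsReflected : Term n → Term n → Set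
  InitialsReflected p q = ∀ {a q'} → q —[ a ]→ q' → Can p a

  ≼⇒Simulated : ∀ {p q} → p ≼ q → Simulated p q
  ≼⇒Simulated (ready-sim sim _) = sim

  ≼⇒InitialsReflected : ∀ {p q} → p ≼ q → InitialsReflected p q
  ≼⇒InitialsReflected (ready-sim _ back) = back

  module UpTo≼ (R : Term n → Term n → Set)
    (simulates : ∀ {p q a p'} → R p q → p —[ a ]→ p' →
                 ∃ λ q' → (q —[ a ]→ q') × (R p' q' ⊎ p' ≼ q'))
    (reflects : ∀ {p q} → R p q → InitialsReflected p q) where

    ⊆≼ : ∀ {p q} → R p q → p ≼ q
    ⊆≼ {p} = bounded (suc (size p)) ≤-refl
      where
      bounded : ∀ k {p q} → size p < k → R p q → p ≼ q
      bounded (suc k) {p} {q} (s≤s p<k) r = ready-sim sim (reflects r)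
        where
        sim : Simulated p q
        sim st with simulates r st
        ... | q' , st' , inj₁ r'  = q' , st' , bounded k (≤-trans (step-size< st) p<k) r'
        ... | q' , st' , inj₂ p≼q = q' , st' , p≼q

  ≼-refl : ∀ {p} → p ≼ p
  ≼-refl = UpTo≼.⊆≼ _≡_ (λ { ≡.refl st → _ , st , inj₁ ≡.refl }) (λ { ≡.refl st → _ , st }) ≡.refl

  matched-exactly : ∀ {q a t} → q —[ a ]→ t → ∃ λ q' → (q —[ a ]→ q') × (t ≼ q')
  matched-exactly st = _ , st , ≼-refl

  data Composed : Term n → Term n → Set where
    composed : ∀ {p q r} → p ≼ q → q ≼ r → Composed p r

  ≼-trans : ∀ {p q r} → p ≼ q → q ≼ r → p ≼ r
  ≼-trans p≼q q≼r = UpTo≼.⊆≼ Composed simulates reflects (composed p≼q q≼r)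
    where
    simulates : ∀ {p r a p'} → Composed p r → p —[ a ]→ p' →
                ∃ λ r' → (r —[ a ]→ r') × (Composed p' r' ⊎ p' ≼ r')
    simulates (composed (ready-sim sim₁ _) (ready-sim sim₂ _)) st with sim₁ st
    ... | q' , st₁ , p'≼q' with sim₂ st₁
    ... | r' , st₂ , q'≼r' = r' , st₂ , inj₁ (composed p'≼q' q'≼r')
    reflects : ∀ {p r} → Composed p r → InitialsReflected p r
    reflects (composed (ready-sim _ back₁) (ready-sim _ back₂)) st = back₁ (proj₂ (back₂ st))

  _≃_ : Term n → Term n → Set
  p ≃ q = (p ≼ q) × (q ≼ p)

  mutually-simulated⇒≃ : ∀ {p q} → Simulated p q → Simulated q p → p ≃ q
  mutually-simulated⇒≃ sim₁ sim₂ =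
    ready-sim sim₁ (λ st → let (p' , st' , _) = sim₂ st in p' , st') ,
    ready-sim sim₂ (λ st → let (q' , st' , _) = sim₁ st in q' , st')

  Simulated-⊕ˡ : ∀ {p q r} → Simulated p r → Simulated q r → Simulated (p ⊕ q) r
  Simulated-⊕ˡ sim₁ sim₂ (sumˡ st) = sim₁ st
  Simulated-⊕ˡ sim₁ sim₂ (sumʳ st) = sim₂ st

  ·-mono-≼ : ∀ {a p q} → p ≼ q → (a · p) ≼ (a · q)
  ·-mono-≼ p≼q = ready-sim (λ { pre → _ , pre , p≼q }) (λ { pre → _ , pre })

  ⊕-mono-≼ : ∀ {p p' q q'} → p ≼ p' → q ≼ q' → (p ⊕ q) ≼ (p' ⊕ q')
  ⊕-mono-≼ (ready-sim simp backp) (ready-sim simq backq) = ready-sim sim back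
    where
    sim : Simulated _ _
    sim (sumˡ st) = let (r , st' , h) = simp st in r , sumˡ st' , h
    sim (sumʳ st) = let (r , st' , h) = simq st in r , sumʳ st' , h
    back : InitialsReflected _ _
    back (sumˡ st) = let (r , st') = backp st in r , sumˡ st'
    back (sumʳ st) = let (r , st') = backq st in r , sumʳ st'

  data ParallelOf≼ : Term n → Term n → Set where
    parallel : ∀ {p p' q q'} → p ≼ p' → q ≼ q' → ParallelOf≼ (p ∥ q) (p' ∥ q')

  ∥-mono-≼ : ∀ {p p' q q'} → p ≼ p' → q ≼ q' → (p ∥ q) ≼ (p' ∥ q')
  ∥-mono-≼ p≼p' q≼q' = UpTo≼.⊆≼ ParallelOf≼ simulates reflects (parallel p≼p' q≼q')
    where
    simulates : ∀ {p q a p'} → ParallelOf≼ p q → p —[ a ]→ p' →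
                ∃ λ q' → (q —[ a ]→ q') × (ParallelOf≼ p' q' ⊎ p' ≼ q')
    simulates (parallel (ready-sim sim _) h) (parˡ st) =
      let (_ , st' , h') = sim st in _ , parˡ st' , inj₁ (parallel h' h)
    simulates (parallel h (ready-sim sim _)) (parʳ st) =
      let (_ , st' , h') = sim st in _ , parʳ st' , inj₁ (parallel h h')
    reflects : ∀ {p q} → ParallelOf≼ p q → InitialsReflected p q
    reflects (parallel (ready-sim _ back) _) (parˡ st) = _ , parˡ (proj₂ (back st))
    reflects (parallel _ (ready-sim _ back)) (parʳ st) = _ , parʳ (proj₂ (back st))

  -- Dropping one of two a-summands is harmless: the other keeps a enabled.
  drop-second-branch-≼ : ∀ {a x y u} → (a · x ⊕ u) ≼ (a · x ⊕ a · y ⊕ u)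
  drop-second-branch-≼ = ready-sim
    (λ { (sumˡ pre) → matched-exactly (sumˡ (sumˡ pre)) ; (sumʳ s) → matched-exactly (sumʳ s) })
    (λ { (sumˡ (sumˡ pre)) → _ , sumˡ pre ; (sumˡ (sumʳ pre)) → _ , sumˡ pre ; (sumʳ s) → _ , sumʳ s })

  drop-first-branch-≼ : ∀ {a x y u} → (a · y ⊕ u) ≼ (a · x ⊕ a · y ⊕ u)
  drop-first-branch-≼ = ready-sim
    (λ { (sumˡ pre) → matched-exactly (sumˡ (sumʳ pre)) ; (sumʳ s) → matched-exactly (sumʳ s) })
    (λ { (sumˡ (sumˡ pre)) → _ , sumˡ pre ; (sumˡ (sumʳ pre)) → _ , sumˡ pre ; (sumʳ s) → _ , sumʳ s })

  PSum-step⁺ : ∀ {l : List (Act n × Term n)} {a t} → (a , t) ∈ l → PSum l —[ a ]→ t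
  PSum-step⁺ {_ ∷ []}    (here ≡.refl) = pre
  PSum-step⁺ {_ ∷ _ ∷ _} (here ≡.refl) = sumˡ pre
  PSum-step⁺ {_ ∷ _ ∷ _} (there a,t∈l) = sumʳ (PSum-step⁺ a,t∈l)

  PSum-step⁻ : ∀ {l : List (Act n × Term n)} {a t} → PSum l —[ a ]→ t → (a , t) ∈ l
  PSum-step⁻ {_ ∷ []}    pre        = here ≡.refl
  PSum-step⁻ {_ ∷ _ ∷ _} (sumˡ pre) = here ≡.refl
  PSum-step⁻ {_ ∷ _ ∷ _} (sumʳ st)  = there (PSum-step⁻ st)

  -- The summand maps in the axioms are pattern lambdas, so they are only
  -- characterised by how they act on pairs.
  ResidualMap : (Act n × Term n → Act n × Term n) → (Term n → Term n) → Set
  ResidualMap f F = ∀ a x → f (a , x) ≡ (a , F x)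

  PSum-map-step⁺ : ∀ {l f F} → ResidualMap f F →
                   ∀ {a x} → (a , x) ∈ l → PSum (map f l) —[ a ]→ F x
  PSum-map-step⁺ {l} {f} f≗F {a} {x} a,x∈l =
    PSum-step⁺ (subst (_∈ map f l) (f≗F a x) (∈-map⁺ f a,x∈l))

  PSum-map-step⁻ : ∀ {l f F} → ResidualMap f F →
                   ∀ {a t} → PSum (map f l) —[ a ]→ t → ∃ λ x → ((a , x) ∈ l) × (t ≡ F x)
  PSum-map-step⁻ {f = f} f≗F st with ∈-map⁻ f (PSum-step⁻ st)
  ... | (a , x) , a,x∈l , eq with ≡.trans eq (f≗F a x)
  ... | ≡.refl = x , a,x∈l , ≡.refl

  PSum-map-Simulated : ∀ {l f F r} → ResidualMap f F →
                       (∀ {a x} → (a , x) ∈ l → r —[ a ]→ F x) → Simulated (PSum (map f l)) r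
  PSum-map-Simulated {l} f≗F step st with PSum-map-step⁻ {l} f≗F st
  ... | x , a,x∈l , ≡.refl = matched-exactly (step a,x∈l)

  ∥-identityʳ : ∀ {x} → (x ∥ 𝟎) ≃ x
  ∥-identityʳ = UpTo≼.⊆≼ (λ p q → p ≡ q ∥ 𝟎 ⊎ q ≡ p ∥ 𝟎) simulates reflects (inj₁ ≡.refl)
              , UpTo≼.⊆≼ (λ p q → p ≡ q ∥ 𝟎 ⊎ q ≡ p ∥ 𝟎) simulates reflects (inj₂ ≡.refl)
    where
    simulates : ∀ {p q a p'} → p ≡ q ∥ 𝟎 ⊎ q ≡ p ∥ 𝟎 → p —[ a ]→ p' →
                ∃ λ q' → (q —[ a ]→ q') × ((p' ≡ q' ∥ 𝟎 ⊎ q' ≡ p' ∥ 𝟎) ⊎ p' ≼ q')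
    simulates (inj₁ ≡.refl) (parˡ st) = _ , st , inj₁ (inj₁ ≡.refl)
    simulates (inj₂ ≡.refl) st        = _ , parˡ st , inj₁ (inj₂ ≡.refl)
    reflects : ∀ {p q} → p ≡ q ∥ 𝟎 ⊎ q ≡ p ∥ 𝟎 → InitialsReflected p q
    reflects (inj₁ ≡.refl) st        = _ , parˡ st
    reflects (inj₂ ≡.refl) (parˡ st) = _ , st

  data Swapped : Term n → Term n → Set where
    swapped : ∀ {x y} → Swapped (x ∥ y) (y ∥ x)

  ∥-comm-≼ : ∀ {x y} → (x ∥ y) ≼ (y ∥ x)
  ∥-comm-≼ = UpTo≼.⊆≼ Swapped
    (λ { swapped (parˡ st) → _ , parʳ st , inj₁ swapped ; swapped (parʳ st) → _ , parˡ st , inj₁ swapped })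
    (λ { swapped (parˡ st) → _ , parʳ st ; swapped (parʳ st) → _ , parˡ st })
    swapped

  RS-≃ : ∀ a b x y z → (a · (b · x ⊕ b · y ⊕ z)) ≃ (a · (b · x ⊕ b · y ⊕ z) ⊕ a · (b · x ⊕ z))
  RS-≃ a b x y z = mutually-simulated⇒≃
    (λ { pre → matched-exactly (sumˡ pre) })
    (λ { (sumˡ pre) → matched-exactly pre ; (sumʳ pre) → _ , pre , drop-second-branch-≼ })

  RSP1-≃ : ∀ a b x y u z w v →
    ((a · x ⊕ a · y ⊕ u) ∥ (b · z ⊕ b · w ⊕ v))
      ≃ (((a · x ⊕ u) ∥ (b · z ⊕ b · w ⊕ v))
         ⊕ ((a · y ⊕ u) ∥ (b · z ⊕ b · w ⊕ v))
         ⊕ ((a · x ⊕ a · y ⊕ u) ∥ (b · z ⊕ v))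
         ⊕ ((a · x ⊕ a · y ⊕ u) ∥ (b · w ⊕ v)))
  RSP1-≃ a b x y u z w v = mutually-simulated⇒≃
    (λ { (parˡ (sumˡ (sumˡ pre))) → matched-exactly (sumˡ (sumˡ (sumˡ (parˡ (sumˡ pre)))))
       ; (parˡ (sumˡ (sumʳ pre))) → matched-exactly (sumˡ (sumˡ (sumʳ (parˡ (sumˡ pre)))))
       ; (parˡ (sumʳ st))         → matched-exactly (sumˡ (sumˡ (sumˡ (parˡ (sumʳ st)))))
       ; (parʳ (sumˡ (sumˡ pre))) → matched-exactly (sumˡ (sumʳ (parʳ (sumˡ pre))))
       ; (parʳ (sumˡ (sumʳ pre))) → matched-exactly (sumʳ (parʳ (sumˡ pre)))
       ; (parʳ (sumʳ st))         → matched-exactly (sumˡ (sumʳ (parʳ (sumʳ st)))) })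
    (Simulated-⊕ˡ
      (Simulated-⊕ˡ
        (Simulated-⊕ˡ (≼⇒Simulated (∥-mono-≼ drop-second-branch-≼ ≼-refl))
                      (≼⇒Simulated (∥-mono-≼ drop-first-branch-≼ ≼-refl)))
        (≼⇒Simulated (∥-mono-≼ ≼-refl drop-second-branch-≼)))
      (≼⇒Simulated (∥-mono-≼ ≼-refl drop-first-branch-≼)))

  RSP2-≃ : ∀ (l : List (Act n × Term n)) b y z w →
    (PSum l ∥ (b · y ⊕ b · z ⊕ w))
      ≃ ((PSum l ∥ (b · y ⊕ w))
         ⊕ (PSum l ∥ (b · z ⊕ w))
         ⊕ PSum (map (λ { (a , x) → (a , (x ∥ (b · y ⊕ b · z ⊕ w))) }) l))
  RSP2-≃ l b y z w = mutually-simulated⇒≃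
    (λ { (parˡ st)               → matched-exactly (sumʳ (PSum-map-step⁺ {l} f≗F (PSum-step⁻ st)))
       ; (parʳ (sumˡ (sumˡ pre))) → matched-exactly (sumˡ (sumˡ (parʳ (sumˡ pre))))
       ; (parʳ (sumˡ (sumʳ pre))) → matched-exactly (sumˡ (sumʳ (parʳ (sumˡ pre))))
       ; (parʳ (sumʳ st))         → matched-exactly (sumˡ (sumˡ (parʳ (sumʳ st)))) })
    (Simulated-⊕ˡ
      (Simulated-⊕ˡ (≼⇒Simulated (∥-mono-≼ ≼-refl drop-second-branch-≼))
                    (≼⇒Simulated (∥-mono-≼ ≼-refl drop-first-branch-≼)))
      (PSum-map-Simulated {l} f≗F (λ a,x∈l → parˡ (PSum-step⁺ a,x∈l))))
    where
    f≗F : ResidualMap _ (_∥ (b · y ⊕ b · z ⊕ w))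
    f≗F _ _ = ≡.refl

  EL2-≃ : ∀ (l k : List (Act n × Term n)) →
    (PSum l ∥ PSum k)
      ≃ (PSum (map (λ { (a , x) → (a , (x ∥ PSum k)) }) l)
         ⊕ PSum (map (λ { (b , y) → (b , (PSum l ∥ y)) }) k))
  EL2-≃ l k = mutually-simulated⇒≃
    (λ { (parˡ st) → matched-exactly (sumˡ (PSum-map-step⁺ {l} left (PSum-step⁻ st)))
       ; (parʳ st) → matched-exactly (sumʳ (PSum-map-step⁺ {k} right (PSum-step⁻ st))) })
    (Simulated-⊕ˡ (PSum-map-Simulated {l} left (λ a,x∈l → parˡ (PSum-step⁺ a,x∈l)))
                  (PSum-map-Simulated {k} right (λ b,y∈k → parʳ (PSum-step⁺ b,y∈k))))
    where
    left : ResidualMap _ (_∥ PSum k)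
    left _ _ = ≡.refl
    right : ResidualMap _ (PSum l ∥_)
    right _ _ = ≡.refl

  E-RS-sound : ∀ {p q} → E-RS p q → p ≃ q
  E-RS-sound (A0 x) = mutually-simulated⇒≃
    (λ { (sumˡ st) → matched-exactly st ; (sumʳ ()) })
    (λ st → matched-exactly (sumˡ st))
  E-RS-sound (A1 x y) = mutually-simulated⇒≃
    (λ { (sumˡ st) → matched-exactly (sumʳ st) ; (sumʳ st) → matched-exactly (sumˡ st) })
    (λ { (sumˡ st) → matched-exactly (sumʳ st) ; (sumʳ st) → matched-exactly (sumˡ st) })
  E-RS-sound (A2 x y z) = mutually-simulated⇒≃
    (λ { (sumˡ (sumˡ st)) → matched-exactly (sumˡ st)
       ; (sumˡ (sumʳ st)) → matched-exactly (sumʳ (sumˡ st))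
       ; (sumʳ st)        → matched-exactly (sumʳ (sumʳ st)) })
    (λ { (sumˡ st)        → matched-exactly (sumˡ (sumˡ st))
       ; (sumʳ (sumˡ st)) → matched-exactly (sumˡ (sumʳ st))
       ; (sumʳ (sumʳ st)) → matched-exactly (sumʳ st) })
  E-RS-sound (A3 x) = mutually-simulated⇒≃
    (λ { (sumˡ st) → matched-exactly st ; (sumʳ st) → matched-exactly st })
    (λ st → matched-exactly (sumˡ st))
  E-RS-sound (P0 x)                   = ∥-identityʳ
  E-RS-sound (P1 x y)                 = ∥-comm-≼ , ∥-comm-≼
  E-RS-sound (RS a b x y z)           = RS-≃ a b x y z
  E-RS-sound (RSP1 a b x y u z w v)   = RSP1-≃ a b x y u z w v
  E-RS-sound (RSP2 l _ b y z w)       = RSP2-≃ l b y z w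
  E-RS-sound (EL2 l k _ _)            = EL2-≃ l k

  ⊢-sound : ∀ {p q} → E-RS ⊢ p ≈ q → p ≃ q
  ⊢-sound (ax e) = E-RS-sound e
  ⊢-sound refl = ≼-refl , ≼-refl
  ⊢-sound (sym d) = let (p≼q , q≼p) = ⊢-sound d in q≼p , p≼q
  ⊢-sound (trans d e) =
    let (p≼q , q≼p) = ⊢-sound d ; (q≼r , r≼q) = ⊢-sound e in ≼-trans p≼q q≼r , ≼-trans r≼q q≼p
  ⊢-sound (cong· d) = let (p≼q , q≼p) = ⊢-sound d in ·-mono-≼ p≼q , ·-mono-≼ q≼p
  ⊢-sound (cong⊕ d e) =
    let (p≼p' , p'≼p) = ⊢-sound d ; (q≼q' , q'≼q) = ⊢-sound e in ⊕-mono-≼ p≼p' q≼q' , ⊕-mono-≼ p'≼p q'≼q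
  ⊢-sound (cong∥ d e) =
    let (p≼p' , p'≼p) = ⊢-sound d ; (q≼q' , q'≼q) = ⊢-sound e in ∥-mono-≼ p≼p' q≼q' , ∥-mono-≼ p'≼p q'≼q

  Closed-step : ∀ {p : Term n} {a p'} → Closed p → p —[ a ]→ p' → Closed p'
  Closed-step (c· c)     pre       = c
  Closed-step (c⊕ c₁ c₂) (sumˡ st) = Closed-step c₁ st
  Closed-step (c⊕ c₁ c₂) (sumʳ st) = Closed-step c₂ st
  Closed-step (c∥ c₁ c₂) (parˡ st) = c∥ (Closed-step c₁ st) c₂
  Closed-step (c∥ c₁ c₂) (parʳ st) = c∥ c₁ (Closed-step c₂ st)

  ClosedReadySimilar : Term n → Term n → Set
  ClosedReadySimilar p q = Closed p × Closed q × (p ≼ q)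

  ClosedReadySimilar-isReadySim : IsReadySim ClosedReadySimilar
  ClosedReadySimilar-isReadySim = record
    { closedˡ = proj₁
    ; closedʳ = λ r → proj₁ (proj₂ r)
    ; init    = λ { (_ , _ , p≼q) a → mk⇔ (λ (_ , st) → let (q' , st' , _) = ≼⇒Simulated p≼q st in q' , st')
                                          (λ (_ , st) → ≼⇒InitialsReflected p≼q st) }
    ; step    = λ { (cp , cq , p≼q) st → let (q' , st' , p'≼q') = ≼⇒Simulated p≼q st in
                                         q' , st' , Closed-step cp st , Closed-step cq st' , p'≼q' }
    }

  ≼⇒⊑RS : ∀ {p q} → Closed p → Closed q → p ≼ q → p ⊑RS q
  ≼⇒⊑RS cp cq p≼q = ClosedReadySimilar , ClosedReadySimilar-isReadySim , cp , cq , p≼q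

theorem3p2 : (n : ℕ) (p q : Term n) → Closed p → Closed q →
    E-RS ⊢ p ≈ q → p ∼RS q
theorem3p2 n p q cp cq d =
  let (p≼q , q≼p) = ⊢-sound d in ≼⇒⊑RS cp cq p≼q , ≼⇒⊑RS cq cp q≼p
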